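{- Let $k\ge 3$, $1\le s\le k-1$, $m$ a positive integer, $n=m(k-s)$ with $n\ge 2k-s$, and let $G$ be the $k$-uniform $s$-cycle with vertex set $[n]$ (labels modulo $n$, so $n+j\equiv j$) and edges $\{1+j(k-s),\dots,s+(j+1)(k-s)\}$ for $j=0,\dots,m-1$. Then $G$ is regular if and only if $k=q(k-s)$ for some positive integer $q$. In this case $d_1=\cdots=d_n=q$.
   Context: The degree $d_i$ of a vertex $i$ is the number of edges containing it; a hypergraph is regular if all vertices have the same degree. -}

module Defs where

open import Data.Nat using (ℕ; _+_; _*_; _∸_; NonZero; _≟_)
open import Data.Nat.DivMod using (_%_)
open import Data.List using (List; map; upTo; filter; length)
open import Data.List.Membership.DecPropositional (_≟_) using (_∈?_)

-- Vertices are 0,…,n-1 (0-indexed: vertex v corresponds to the paper's label v+1).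
-- Edge j (0 ≤ j < m) of the k-uniform s-cycle on n vertices consists of the
-- paper's labels 1+j(k-s), …, s+(j+1)(k-s) = j(k-s)+k, taken modulo n,
-- i.e. the 0-indexed vertices (j(k-s)+t) mod n for t = 0,…,k-1.
cycleEdge : (k s n : ℕ) → .{{NonZero n}} → ℕ → List ℕ
cycleEdge k s n j = map (λ t → (j * (k ∸ s) + t) % n) (upTo k)

cycleEdges : (k s m n : ℕ) → .{{NonZero n}} → List (List ℕ)
cycleEdges k s m n = map (cycleEdge k s n) (upTo m)

degree : List (List ℕ) → ℕ → ℕ
degree E v = length (filter (v ∈?_) E)

Regular : ℕ → List (List ℕ) → Set
Regular n E = ∀ u v → u Data.Nat.< n → v Data.Nat.< n → degree E u ≡ degree E v
  where open import Relation.Binary.PropositionalEquality using (_≡_)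

-- Write d = k - s (the shift between consecutive edges), so n = m d and
-- edge j is the cyclic interval of length k ≤ n starting at j d.  A vertex v
-- lies in edge j iff its offset (v + (m - j) d) mod n from the start of the
-- edge is below k.  Summing over j, reversing the order of summation and
-- rotating the (m-periodic) summand shows that the vertex v = a d + r
-- (a < m, r < d) has degree  #{ i < m | i d + r < k }.  Writing k = q d + ρ
-- with ρ < d, comparison of base-d "digits" identifies this count as
-- [r < ρ] + q.  Hence every degree is q when ρ = 0, while for ρ > 0 the
-- vertices 0 and d - 1 have degrees q + 1 and q; so G is regular iff d ∣ k.
module Submission where

open import Defs
open import Data.Nat
open import Data.Nat.Properties
open import Data.Nat.DivMod using (_%_; _/_; [m+n]%n≡m%n; %-distribˡ-+; m%n%n≡m%n; m<n⇒m%n≡m; m≡m%n+[m/n]*n; m%n<n; m<n*o⇒m/o<n)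
open import Data.List using (List; map; upTo; filter; length; _++_; [_])
open import Data.List.Properties using (upTo-∷ʳ; map-++; filter-++; length-++)
open import Data.List.Membership.Propositional using (_∈_)
open import Data.List.Membership.DecPropositional (_≟_) using (_∈?_)
open import Data.List.Membership.Propositional.Properties using (∈-map⁺; ∈-map⁻; ∈-upTo⁺; ∈-upTo⁻)
open import Data.Product using (_×_; ∃-syntax; _,_; proj₁; proj₂)
open import Data.Empty using (⊥-elim)
open import Relation.Nullary using (Dec; yes; no; ¬_)
open import Relation.Unary using (Decidable)
open import Relation.Binary.PropositionalEquality hiding ([_])
open import Function.Bundles using (_⇔_; mk⇔; Equivalence)
open import Data.Nat.Tactic.RingSolver using (solve-∀)

open Equivalence using (to; from)

𝟙 : ∀ {P : Set} → Dec P → ℕ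
𝟙 (yes _) = 1
𝟙 (no _)  = 0

𝟙-no : ∀ {P : Set} → ¬ P → (p : Dec P) → 𝟙 p ≡ 0
𝟙-no ¬p (yes p) = ⊥-elim (¬p p)
𝟙-no ¬p (no _)  = refl

𝟙≡0⇒¬ : ∀ {P : Set} (p : Dec P) → 𝟙 p ≡ 0 → ¬ P
𝟙≡0⇒¬ (no ¬p) _ = ¬p

𝟙-cong : ∀ {P Q : Set} → P ⇔ Q → (p : Dec P) (q : Dec Q) → 𝟙 p ≡ 𝟙 q
𝟙-cong _   (yes _)  (yes _)  = refl
𝟙-cong P⇔Q (yes p)  (no ¬q)  = ⊥-elim (¬q (to P⇔Q p))
𝟙-cong P⇔Q (no ¬p)  (yes q)  = ⊥-elim (¬p (from P⇔Q q))
𝟙-cong _   (no _)   (no _)   = refl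

sumBelow : (ℕ → ℕ) → ℕ → ℕ
sumBelow f zero    = 0
sumBelow f (suc m) = sumBelow f m + f m

sum-ext : ∀ {f g} m → (∀ j → j < m → f j ≡ g j) → sumBelow f m ≡ sumBelow g m
sum-ext zero    f≡g = refl
sum-ext (suc m) f≡g = cong₂ _+_ (sum-ext m (λ j j<m → f≡g j (m<n⇒m<1+n j<m))) (f≡g m ≤-refl)

sum-split-first : ∀ f m → sumBelow f (suc m) ≡ f 0 + sumBelow (λ i → f (suc i)) m
sum-split-first f zero    = +-comm 0 (f 0)
sum-split-first f (suc m) = begin
    sumBelow f (suc m) + f (suc m)                  ≡⟨ cong (_+ f (suc m)) (sum-split-first f m) ⟩
    f 0 + sumBelow (λ i → f (suc i)) m + f (suc m)  ≡⟨ +-assoc (f 0) _ _ ⟩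
    f 0 + sumBelow (λ i → f (suc i)) (suc m)        ∎
  where open ≡-Reasoning

sum-reverse : ∀ f m → sumBelow (λ j → f (m ∸ suc j)) m ≡ sumBelow f m
sum-reverse f zero    = refl
sum-reverse f (suc m) = begin
    sumBelow (λ j → f (m ∸ j)) m + f (m ∸ m)
      ≡⟨ cong₂ _+_ (sum-ext m (λ j j<m → cong f (∸-suc j<m))) (cong f (n∸n≡0 m)) ⟩
    sumBelow (λ j → f (suc (m ∸ suc j))) m + f 0
      ≡⟨ cong (_+ f 0) (sum-reverse (λ i → f (suc i)) m) ⟩
    sumBelow (λ i → f (suc i)) m + f 0
      ≡⟨ +-comm _ (f 0) ⟩
    f 0 + sumBelow (λ i → f (suc i)) m
      ≡⟨ sum-split-first f m ⟨
    sumBelow f (suc m) ∎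
  where
  open ≡-Reasoning
  ∸-suc : ∀ {j} → j < m → m ∸ j ≡ suc (m ∸ suc j)
  ∸-suc {j} j<m = +-∸-assoc 1 {m} {suc j} j<m

sum-rotate-one : ∀ f m → f m ≡ f 0 → sumBelow (λ i → f (suc i)) m ≡ sumBelow f m
sum-rotate-one f m fm≡f0 = +-cancelʳ-≡ (f 0) _ _ (begin
    sumBelow (λ i → f (suc i)) m + f 0   ≡⟨ +-comm _ (f 0) ⟩
    f 0 + sumBelow (λ i → f (suc i)) m   ≡⟨ sum-split-first f m ⟨
    sumBelow f m + f m                   ≡⟨ cong (sumBelow f m +_) fm≡f0 ⟩
    sumBelow f m + f 0                   ∎)
  where open ≡-Reasoning

sum-rotate : ∀ m f → (∀ i → f (i + m) ≡ f i) → ∀ a → sumBelow (λ i → f (a + i)) m ≡ sumBelow f m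
sum-rotate m f periodic zero    = refl
sum-rotate m f periodic (suc a) =
  trans (sum-rotate m (λ i → f (suc i)) (λ i → periodic (suc i)) a)
        (sum-rotate-one f m (periodic 0))

sum-below-threshold : ∀ c m → sumBelow (λ i → 𝟙 (i <? c)) m ≡ m ⊓ c
sum-below-threshold c zero    = refl
sum-below-threshold c (suc m) with m <? c
... | yes m<c = trans (cong (_+ 1) (trans (sum-below-threshold c m) (m≤n⇒m⊓n≡m (<⇒≤ m<c))))
                      (trans (+-comm m 1) (sym (m≤n⇒m⊓n≡m m<c)))
... | no  m≮c = trans (+-identityʳ _)
                      (trans (sum-below-threshold c m)
                             (trans (m≥n⇒m⊓n≡n (≮⇒≥ m≮c)) (sym (m≥n⇒m⊓n≡n (m≤n⇒m≤1+n (≮⇒≥ m≮c))))))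

count-threshold : ∀ {P : ℕ → Set} (P? : Decidable P) {c} m →
  (∀ i → P i ⇔ i < c) → ¬ P m → sumBelow (λ i → 𝟙 (P? i)) m ≡ c
count-threshold P? {c} m P⇔<c ¬Pm = begin
    sumBelow (λ i → 𝟙 (P? i)) m    ≡⟨ sum-ext m (λ i _ → 𝟙-cong (P⇔<c i) (P? i) (i <? c)) ⟩
    sumBelow (λ i → 𝟙 (i <? c)) m  ≡⟨ sum-below-threshold c m ⟩
    m ⊓ c                          ≡⟨ m≥n⇒m⊓n≡n c≤m ⟩
    c                              ∎
  where
  open ≡-Reasoning
  c≤m : c ≤ m
  c≤m = ≮⇒≥ (λ m<c → ¬Pm (from (P⇔<c m) m<c))

count-map-upTo : ∀ {A : Set} {P : A → Set} (P? : Decidable P) (f : ℕ → A) m →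
  length (filter P? (map f (upTo m))) ≡ sumBelow (λ j → 𝟙 (P? (f j))) m
count-map-upTo P? f zero    = refl
count-map-upTo P? f (suc m) = begin
    length (filter P? (map f (upTo (suc m))))
      ≡⟨ cong (λ l → length (filter P? (map f l))) (sym (upTo-∷ʳ m)) ⟩
    length (filter P? (map f (upTo m ++ [ m ])))
      ≡⟨ cong (λ l → length (filter P? l)) (map-++ f (upTo m) [ m ]) ⟩
    length (filter P? (map f (upTo m) ++ [ f m ]))
      ≡⟨ cong length (filter-++ P? (map f (upTo m)) [ f m ]) ⟩
    length (filter P? (map f (upTo m)) ++ filter P? [ f m ])
      ≡⟨ length-++ (filter P? (map f (upTo m))) ⟩
    length (filter P? (map f (upTo m))) + length (filter P? [ f m ])
      ≡⟨ cong₂ _+_ (count-map-upTo P? f m) (count-singleton (f m)) ⟩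
    sumBelow (λ j → 𝟙 (P? (f j))) (suc m) ∎
  where
  open ≡-Reasoning
  count-singleton : ∀ x → length (filter P? [ x ]) ≡ 𝟙 (P? x)
  count-singleton x with P? x
  ... | yes _ = refl
  ... | no  _ = refl

undo-shift : ∀ n .{{_ : NonZero n}} x z t → x + z ≡ n → ((x + t) % n + z) % n ≡ t % n
undo-shift n x z t x+z≡n = begin
    ((x + t) % n + z) % n          ≡⟨ %-distribˡ-+ ((x + t) % n) z n ⟩
    ((x + t) % n % n + z % n) % n  ≡⟨ cong (λ y → (y + z % n) % n) (m%n%n≡m%n (x + t) n) ⟩
    ((x + t) % n + z % n) % n      ≡⟨ %-distribˡ-+ (x + t) z n ⟨
    (x + t + z) % n                ≡⟨ cong (_% n) (rearrange x t z) ⟩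
    (t + (x + z)) % n              ≡⟨ cong (λ y → (t + y) % n) x+z≡n ⟩
    (t + n) % n                    ≡⟨ [m+n]%n≡m%n t n ⟩
    t % n                          ∎
  where
  open ≡-Reasoning
  rearrange : ∀ x t z → x + t + z ≡ t + (x + z)
  rearrange = solve-∀

cyclic-interval-∈ : ∀ n .{{_ : NonZero n}} k x z v → k ≤ n → x + z ≡ n → v < n →
  (v ∈ map (λ t → (x + t) % n) (upTo k)) ⇔ ((v + z) % n < k)
cyclic-interval-∈ n k x z v k≤n x+z≡n v<n = mk⇔ offset<k in-interval
  where
  offset<k : v ∈ map (λ t → (x + t) % n) (upTo k) → (v + z) % n < k
  offset<k v∈ with ∈-map⁻ (λ t → (x + t) % n) v∈
  ... | t , t∈ , refl = subst (_< k) (sym offset≡t) t<k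
    where
    t<k : t < k
    t<k = ∈-upTo⁻ t∈
    offset≡t : ((x + t) % n + z) % n ≡ t
    offset≡t = trans (undo-shift n x z t x+z≡n) (m<n⇒m%n≡m (<-≤-trans t<k k≤n))
  in-interval : (v + z) % n < k → v ∈ map (λ t → (x + t) % n) (upTo k)
  in-interval offset<k = subst (_∈ map (λ t → (x + t) % n) (upTo k)) lands-on-v
    (∈-map⁺ (λ t → (x + t) % n) (∈-upTo⁺ offset<k))
    where
    lands-on-v : (x + (v + z) % n) % n ≡ v
    lands-on-v = begin
      (x + (v + z) % n) % n   ≡⟨ cong (_% n) (+-comm x _) ⟩
      ((v + z) % n + x) % n   ≡⟨ cong (λ y → (y % n + x) % n) (+-comm v z) ⟩
      ((z + v) % n + x) % n   ≡⟨ undo-shift n z x v (trans (+-comm z x) x+z≡n) ⟩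
      v % n                   ≡⟨ m<n⇒m%n≡m v<n ⟩
      v                       ∎
      where open ≡-Reasoning

digit-order : ∀ d i q {r ρ} → r < d → ρ < d → (i * d + r < q * d + ρ) ⇔ (i < 𝟙 (r <? ρ) + q)
digit-order d i q {r} {ρ} r<d ρ<d with r <? ρ
... | yes r<ρ = mk⇔ (λ lt → *-cancelʳ-< d i (suc q) (≤-<-trans (m≤m+n (i * d) r) (<-trans lt below-next)))
                    (λ i≤q → +-mono-≤-< (*-monoˡ-≤ d (s≤s⁻¹ i≤q)) r<ρ)
  where
  below-next : q * d + ρ < suc q * d
  below-next = subst (q * d + ρ <_) (+-comm (q * d) d) (+-monoʳ-< (q * d) ρ<d)
... | no  r≮ρ = mk⇔ (λ lt → *-cancelʳ-< d i q (+-cancelʳ-< r (i * d) (q * d)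
                               (<-≤-trans lt (+-monoʳ-≤ (q * d) (≮⇒≥ r≮ρ)))))
                    (λ i<q → begin-strict
                       i * d + r   <⟨ +-monoʳ-< (i * d) r<d ⟩
                       i * d + d   ≡⟨ +-comm (i * d) d ⟩
                       suc i * d   ≤⟨ *-monoˡ-≤ d i<q ⟩
                       q * d       ≤⟨ m≤m+n (q * d) ρ ⟩
                       q * d + ρ   ∎)
  where open ≤-Reasoning

module Cycle (k s m n : ℕ) .{{_ : NonZero n}} (d≥1 : 1 ≤ k ∸ s) (n≡md : n ≡ m * (k ∸ s)) (k≤n : k ≤ n) where

  d : ℕ
  d = k ∸ s

  instance
    d≢0 : NonZero d
    d≢0 = >-nonZero d≥1

  G : List (List ℕ)
  G = cycleEdges k s m n

  ∈-edge : ∀ j v → j < m → v < n → (v ∈ cycleEdge k s n j) ⇔ ((v + (m ∸ j) * d) % n < k)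
  ∈-edge j v j<m v<n = cyclic-interval-∈ n k (j * d) ((m ∸ j) * d) v k≤n starts-sum v<n
    where
    starts-sum : j * d + (m ∸ j) * d ≡ n
    starts-sum = trans (sym (*-distribʳ-+ d j (m ∸ j)))
                       (trans (cong (_* d) (m+[n∸m]≡n (<⇒≤ j<m))) (sym n≡md))

  -- The degree of v is Σ_{i<m} [(v + i d) mod n < k]: sum over the edges in
  -- reverse order and rotate the m-periodic summand by one step.
  degree-as-sum : ∀ v → v < n → degree G v ≡ sumBelow (λ i → 𝟙 ((v + i * d) % n <? k)) m
  degree-as-sum v v<n = begin
      degree G v
        ≡⟨ count-map-upTo (v ∈?_) (cycleEdge k s n) m ⟩
      sumBelow (λ j → 𝟙 (v ∈? cycleEdge k s n j)) m
        ≡⟨ sum-ext m (λ j j<m → 𝟙-cong (∈-edge j v j<m v<n) _ _) ⟩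
      sumBelow (λ j → offset-below (m ∸ j)) m
        ≡⟨ sum-ext m (λ j j<m → cong offset-below (+-∸-assoc 1 {m} {suc j} j<m)) ⟩
      sumBelow (λ j → offset-below (suc (m ∸ suc j))) m
        ≡⟨ sum-reverse (λ i → offset-below (suc i)) m ⟩
      sumBelow (λ i → offset-below (suc i)) m
        ≡⟨ sum-rotate-one offset-below m (offset-periodic 0) ⟩
      sumBelow offset-below m ∎
    where
    open ≡-Reasoning
    offset-below : ℕ → ℕ
    offset-below i = 𝟙 ((v + i * d) % n <? k)
    offset-periodic : ∀ i → offset-below (i + m) ≡ offset-below i
    offset-periodic i = cong (λ x → 𝟙 (x <? k)) (begin
      (v + (i + m) * d) % n      ≡⟨ cong (_% n) (distribute v i m d) ⟩
      (v + i * d + m * d) % n    ≡⟨ cong (λ y → (v + i * d + y) % n) n≡md ⟨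
      (v + i * d + n) % n        ≡⟨ [m+n]%n≡m%n (v + i * d) n ⟩
      (v + i * d) % n            ∎)
      where
      distribute : ∀ v i m d → v + (i + m) * d ≡ v + i * d + m * d
      distribute = solve-∀

  digits<n : ∀ {a r} → a < m → r < d → a * d + r < n
  digits<n {a} {r} a<m r<d = begin-strict
    a * d + r   <⟨ +-monoʳ-< (a * d) r<d ⟩
    a * d + d   ≡⟨ +-comm (a * d) d ⟩
    suc a * d   ≤⟨ *-monoˡ-≤ d a<m ⟩
    m * d       ≡⟨ n≡md ⟨
    n           ∎
    where open ≤-Reasoning

  -- The degree of the vertex a d + r (a < m, r < d) is #{i < m | i d + r < k}:
  -- rotate the summand of degree-as-sum by a steps.
  degree-digits : ∀ a r → a < m → r < d → degree G (a * d + r) ≡ sumBelow (λ i → 𝟙 (i * d + r <? k)) m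
  degree-digits a r a<m r<d = begin
      degree G (a * d + r)
        ≡⟨ degree-as-sum (a * d + r) (position<n a<m) ⟩
      sumBelow (λ i → 𝟙 ((a * d + r + i * d) % n <? k)) m
        ≡⟨ sum-ext m (λ i _ → cong (λ x → 𝟙 (x % n <? k)) (regroup a r i d)) ⟩
      sumBelow (λ i → below-k (a + i)) m
        ≡⟨ sum-rotate m below-k below-k-periodic a ⟩
      sumBelow below-k m
        ≡⟨ sum-ext m (λ i i<m → cong (λ x → 𝟙 (x <? k)) (m<n⇒m%n≡m (position<n i<m))) ⟩
      sumBelow (λ i → 𝟙 (i * d + r <? k)) m ∎
    where
    open ≡-Reasoning
    position<n : ∀ {i} → i < m → i * d + r < n
    position<n i<m = digits<n i<m r<d
    regroup : ∀ a r i d → a * d + r + i * d ≡ (a + i) * d + r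
    regroup = solve-∀
    below-k : ℕ → ℕ
    below-k x = 𝟙 ((x * d + r) % n <? k)
    below-k-periodic : ∀ x → below-k (x + m) ≡ below-k x
    below-k-periodic x = cong (λ y → 𝟙 (y <? k)) (begin
      ((x + m) * d + r) % n      ≡⟨ cong (_% n) (shuffle x m d r) ⟩
      (x * d + r + m * d) % n    ≡⟨ cong (λ y → (x * d + r + y) % n) n≡md ⟨
      (x * d + r + n) % n        ≡⟨ [m+n]%n≡m%n (x * d + r) n ⟩
      (x * d + r) % n            ∎)
      where
      shuffle : ∀ x m d r → (x + m) * d + r ≡ x * d + r + m * d
      shuffle = solve-∀

  degree-formula : ∀ q ρ a r → k ≡ q * d + ρ → ρ < d → a < m → r < d →
    degree G (a * d + r) ≡ 𝟙 (r <? ρ) + q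
  degree-formula q ρ a r k≡ ρ<d a<m r<d =
    trans (degree-digits a r a<m r<d)
          (count-threshold (λ i → i * d + r <? k) m threshold fails-at-m)
    where
    threshold : ∀ i → (i * d + r < k) ⇔ (i < 𝟙 (r <? ρ) + q)
    threshold i = subst (λ k′ → (i * d + r < k′) ⇔ (i < 𝟙 (r <? ρ) + q)) (sym k≡)
                        (digit-order d i q r<d ρ<d)
    fails-at-m : ¬ (m * d + r < k)
    fails-at-m lt = <-irrefl refl (<-≤-trans lt (≤-trans k≤n (≤-trans (≤-reflexive n≡md) (m≤m+n (m * d) r))))

  digits : ∀ v → v < n → ∃[ a ] ∃[ r ] (a < m × r < d × v ≡ a * d + r)
  digits v v<n = v / d , v % d , m<n*o⇒m/o<n (subst (v <_) n≡md v<n) , m%n<n v d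
               , trans (m≡m%n+[m/n]*n v d) (+-comm (v % d) _)

  degree-when-divisible : ∀ q → k ≡ q * d → ∀ v → v < n → degree G v ≡ q
  degree-when-divisible q k≡qd v v<n with digits v v<n
  ... | a , r , a<m , r<d , refl =
    degree-formula q 0 a r (trans k≡qd (sym (+-identityʳ _))) d≥1 a<m r<d

  -- Conversely, if G is regular then d ∣ k: writing k = q d + ρ, vertex 0 has
  -- degree [0 < ρ] + q while vertex d - 1 has degree q, forcing ρ = 0.
  regular⇒divisible : 1 ≤ m → Regular n G → ∃[ q ] (k ≡ q * d)
  regular⇒divisible 1≤m regular = q , trans k≡qd+ρ (trans (cong (q * d +_) ρ≡0) (+-identityʳ _))
    where
    q = k / d
    ρ = k % d
    ρ<d = m%n<n k d
    k≡qd+ρ : k ≡ q * d + ρ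
    k≡qd+ρ = trans (m≡m%n+[m/n]*n k d) (+-comm ρ _)
    d∸1<d : d ∸ 1 < d
    d∸1<d = ≤-reflexive (m+[n∸m]≡n d≥1)
    d≤n : d ≤ n
    d≤n = ≤-trans (m≤m*n d m {{>-nonZero 1≤m}}) (≤-reflexive (trans (*-comm d m) (sym n≡md)))
    ρ≯d∸1 : ¬ (d ∸ 1 < ρ)
    ρ≯d∸1 lt = <⇒≱ ρ<d (subst (_≤ ρ) (m+[n∸m]≡n d≥1) lt)
    degrees-differ-by : 𝟙 (0 <? ρ) + q ≡ 0 + q
    degrees-differ-by = begin
      𝟙 (0 <? ρ) + q        ≡⟨ degree-formula q ρ 0 0 k≡qd+ρ ρ<d 1≤m d≥1 ⟨
      degree G 0            ≡⟨ regular 0 (d ∸ 1) (<-≤-trans d≥1 d≤n) (<-≤-trans d∸1<d d≤n) ⟩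
      degree G (d ∸ 1)      ≡⟨ degree-formula q ρ 0 (d ∸ 1) k≡qd+ρ ρ<d 1≤m d∸1<d ⟩
      𝟙 (d ∸ 1 <? ρ) + q    ≡⟨ cong (_+ q) (𝟙-no ρ≯d∸1 (d ∸ 1 <? ρ)) ⟩
      0 + q                 ∎
      where open ≡-Reasoning
    ρ≡0 : ρ ≡ 0
    ρ≡0 = n≤0⇒n≡0 (≮⇒≥ (𝟙≡0⇒¬ (0 <? ρ) (+-cancelʳ-≡ q _ 0 degrees-differ-by)))

cycle-bounds : ∀ k s n → 3 ≤ k → s ≤ k ∸ 1 → 2 * k ∸ s ≤ n → s < k × k ≤ n
cycle-bounds k s n 3≤k s≤k-1 2k-s≤n = s<k , k≤n
  where
  s<k : s < k
  s<k = <-≤-trans (s≤s s≤k-1) (≤-reflexive (m+[n∸m]≡n (≤-trans (s≤s z≤n) 3≤k)))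
  k≤n : k ≤ n
  k≤n = begin
    k                ≤⟨ m≤m+n k (k ∸ s) ⟩
    k + (k ∸ s)      ≡⟨ +-∸-assoc k (<⇒≤ s<k) ⟨
    (k + k) ∸ s      ≡⟨ cong (λ x → (k + x) ∸ s) (+-identityʳ k) ⟨
    2 * k ∸ s        ≤⟨ 2k-s≤n ⟩
    n                ∎
    where open ≤-Reasoning

proposition3p1 : (k s m n : ℕ) → .{{_ : NonZero n}} →
    3 ≤ k → 1 ≤ s → s ≤ k ∸ 1 → 1 ≤ m → n ≡ m * (k ∸ s) → 2 * k ∸ s ≤ n →
    (Regular n (cycleEdges k s m n) ⇔ (∃[ q ] (1 ≤ q × k ≡ q * (k ∸ s))))
    × (∀ q → 1 ≤ q → k ≡ q * (k ∸ s) → ∀ v → v < n → degree (cycleEdges k s m n) v ≡ q)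
proposition3p1 k s m n 3≤k _ s≤k-1 1≤m n≡md 2k-s≤n =
  mk⇔ regular⇒d∣k d∣k⇒regular , λ q _ → degree-when-divisible q
  where
  bounds = cycle-bounds k s n 3≤k s≤k-1 2k-s≤n
  open Cycle k s m n (m<n⇒0<n∸m (proj₁ bounds)) n≡md (proj₂ bounds)

  positive : ∀ {q} → k ≡ q * d → 1 ≤ q
  positive {zero}  k≡0 with () ← subst (3 ≤_) k≡0 3≤k
  positive {suc q} _ = s≤s z≤n

  regular⇒d∣k : Regular n G → ∃[ q ] (1 ≤ q × k ≡ q * d)
  regular⇒d∣k regular with regular⇒divisible 1≤m regular
  ... | q , k≡qd = q , positive k≡qd , k≡qd

  d∣k⇒regular : ∃[ q ] (1 ≤ q × k ≡ q * d) → Regular n G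
  d∣k⇒regular (q , _ , k≡qd) u v u<n v<n =
    trans (degree-when-divisible q k≡qd u u<n) (sym (degree-when-divisible q k≡qd v v<n))
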